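{- For every integer $k\ge 7$, the path $P_k$ defines the graphs $P_4$ and $P_5$; that is, there are coalition partitions $\Psi_1,\Psi_2$ of $P_k$ with $\mathrm{CG}(P_k,\Psi_1)\cong P_4$ and $\mathrm{CG}(P_k,\Psi_2)\cong P_5$.
   Context: For a graph $G$ with vertex set $V$, a set $S\subseteq V$ is a dominating set if every vertex of $V\setminus S$ is adjacent to a vertex of $S$. Two disjoint sets $V_1,V_2\subseteq V$ form a coalition in $G$ if neither is a dominating set of $G$ but $V_1\cup V_2$ is. A coalition partition of $G$ is a partition $\Psi=\{V_1,\ldots,V_k\}$ of $V$ such that every $V_i\in\Psi$ is either a dominating set of $G$ with $|V_i|=1$, or is not a dominating set and forms a coalition with some $V_j\in\Psi$. Given a coalition partition $\Psi$ of $G$, the coalition graph $\mathrm{CG}(G,\Psi)$ has vertex set $\Psi$, two members adjacent iff they form a coalition in $G$. $P_k$ is the path on $k$ vertices. -}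

module Defs where

open import Data.Nat using (ℕ; suc; _+_)
open import Data.Fin using (Fin; toℕ)
open import Data.Product using (Σ; ∃; _×_; _,_)
open import Data.Sum using (_⊎_)
open import Relation.Nullary using (¬_)
open import Relation.Binary.PropositionalEquality using (_≡_; _≢_)
open import Function.Bundles using (_⇔_; _↔_; Inverse)

record Graph (n : ℕ) : Set₁ where
  field
    Adj : Fin n → Fin n → Set
open Graph public

PathAdj : (n : ℕ) → Fin n → Fin n → Set
PathAdj n i j = (suc (toℕ i) ≡ toℕ j) ⊎ (suc (toℕ j) ≡ toℕ i)

P : (n : ℕ) → Graph n
P n = record { Adj = PathAdj n }

VSet : ℕ → Set₁
VSet n = Fin n → Set

Dominating : {n : ℕ} → Graph n → VSet n → Set
Dominating {n} G S = (v : Fin n) → ¬ S v → ∃ λ u → S u × Adj G u v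

_∪_ : {n : ℕ} → VSet n → VSet n → VSet n
(A ∪ B) v = A v ⊎ B v

-- A partition of V(G) = Fin n into m (nonempty) classes, given by a
-- surjective class-labelling map.
record Partition (n m : ℕ) : Set where
  field
    cls  : Fin n → Fin m
    onto : (i : Fin m) → ∃ λ v → cls v ≡ i
open Partition public

Class : {n m : ℕ} → Partition n m → Fin m → VSet n
Class Ψ i v = cls Ψ v ≡ i

Singleton : {n : ℕ} → VSet n → Set
Singleton {n} S = ∃ λ v → (u : Fin n) → S u ⇔ (u ≡ v)

-- Two disjoint sets form a coalition: neither dominates, union dominates.
-- (Distinct classes of a partition are disjoint.)
Coalition : {n m : ℕ} → Graph n → Partition n m → Fin m → Fin m → Set
Coalition G Ψ i j =
  (i ≢ j) × ¬ Dominating G (Class Ψ i) × ¬ Dominating G (Class Ψ j)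
  × Dominating G (Class Ψ i ∪ Class Ψ j)

IsCoalitionPartition : {n m : ℕ} → Graph n → Partition n m → Set
IsCoalitionPartition G Ψ = (i : _) →
    (Dominating G (Class Ψ i) × Singleton (Class Ψ i))
  ⊎ (¬ Dominating G (Class Ψ i) × ∃ λ j → Coalition G Ψ i j)

CG : {n m : ℕ} → (G : Graph n) → Partition n m → Graph m
CG G Ψ = record { Adj = Coalition G Ψ }

_≅_ : {m : ℕ} → Graph m → Graph m → Set
_≅_ {m} G H = Σ (Fin m ↔ Fin m) λ σ →
  (a b : Fin m) → Adj G (Inverse.to σ a) (Inverse.to σ b) ⇔ Adj H a b

-- Partition the path v₀ v₁ … v_{k-1} by a colour sequence that is eventually
-- 2-periodic (a fixed prefix, then two colours alternating). Whether a union
-- of colour classes dominates P_k is then decided by the prefix and the first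
-- period alone, uniformly in k: in the periodic part every vertex lies in the
-- set or has its left neighbour in it as soon as the first two periodic
-- vertices meet the set. So for one explicit colouring with four colours and
-- one with five, all (non-)coalitions among the classes are settled by a
-- finite computation, and they are exactly the edges of P₄ and P₅.
module Submission where

open import Defs
open import Data.Nat using (ℕ; zero; suc; pred; s≤s; _≤_; _<_; _≥_; _≤′_; ≤′-refl; ≤′-step; _≟_; _<?_)
open import Data.Nat.Properties using (≤-trans; ≤-<-trans; ≮⇒≥; ≤′⇒≤; ≤⇒≤′)
open import Data.Fin using (Fin; toℕ; fromℕ<; inject₁; inject≤; #_)
  renaming (zero to fzero; suc to fsuc; _≟_ to _≟ᶠ_)
open import Data.Fin.Properties using (toℕ<n; toℕ-fromℕ<; toℕ-inject₁; toℕ-inject≤; all?; any?)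
open import Data.List using (List; []; _∷_; length)
open import Data.Empty using (⊥-elim)
open import Data.Product using (Σ; ∃; _×_; _,_)
open import Data.Sum using (_⊎_; inj₁; inj₂; [_,_]′)
import Data.Sum as Sum
open import Function using (_∘_)
open import Function.Bundles using (_⇔_; mk⇔; Equivalence)
open import Function.Construct.Identity using (↔-id)
open import Relation.Nullary using (¬_; Dec; yes; no; ¬?)
open import Relation.Nullary.Decidable using (_⊎-dec_; _×-dec_; _→-dec_; map′; from-yes; decidable-stable)
open import Relation.Unary using (Decidable)
open import Relation.Binary.PropositionalEquality using (_≡_; _≢_; refl; sym; trans; cong; subst)

module PathDomination (S : ℕ → Set) where

  Near : ℕ → Set
  Near n = S (pred n) ⊎ S n ⊎ S (suc n)

  -- a finite certificate that S dominates every P_k with p < k, once S is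
  -- 2-periodic from p on
  Covers : ℕ → Set
  Covers p = ((i : Fin p) → Near (toℕ i)) × (S (pred p) ⊎ S p) × (S p ⊎ S (suc p))

  Misses : ℕ → Set
  Misses p = ∃ λ (i : Fin (suc p)) → ¬ Near (toℕ i)

  Neighbour : ∀ {k} → Fin k → Set
  Neighbour {k} v = ∃ λ u → S (toℕ u) × PathAdj k u v

  left-neighbour : ∀ {k} (v : Fin k) → ¬ S (toℕ v) → S (pred (toℕ v)) → Neighbour v
  left-neighbour fzero    v∉S Sₗ = ⊥-elim (v∉S Sₗ)
  left-neighbour (fsuc i) _   Sₗ =
    inject₁ i , subst S (sym (toℕ-inject₁ i)) Sₗ , inj₁ (cong suc (toℕ-inject₁ i))

  right-neighbour : ∀ {k} (v : Fin k) (v+1<k : suc (toℕ v) < k) → S (suc (toℕ v)) → Neighbour v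
  right-neighbour v v+1<k Sᵣ =
    fromℕ< v+1<k , subst S (sym (toℕ-fromℕ< v+1<k)) Sᵣ , inj₂ (sym (toℕ-fromℕ< v+1<k))

  near-neighbour : ∀ {k} (v : Fin k) → ¬ S (toℕ v) → suc (toℕ v) < k → Near (toℕ v) → Neighbour v
  near-neighbour v v∉S _     (inj₁ Sₗ)        = left-neighbour v v∉S Sₗ
  near-neighbour v v∉S _     (inj₂ (inj₁ Sᵥ)) = ⊥-elim (v∉S Sᵥ)
  near-neighbour v _   v+1<k (inj₂ (inj₂ Sᵣ)) = right-neighbour v v+1<k Sᵣ

  ¬Near⇒¬dominating : ∀ {k n} → n < k → ¬ Near n → ¬ Dominating (P k) (S ∘ toℕ)
  ¬Near⇒¬dominating n<k ¬near dom
    with dom (fromℕ< n<k) (¬near ∘ inj₂ ∘ inj₁ ∘ subst S (toℕ-fromℕ< n<k))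
  ... | u , Sᵤ , inj₁ u+1≡v =
    ¬near (inj₁ (subst S (cong pred (trans u+1≡v (toℕ-fromℕ< n<k))) Sᵤ))
  ... | u , Sᵤ , inj₂ v+1≡u =
    ¬near (inj₂ (inj₂ (subst S (trans (sym v+1≡u) (cong suc (toℕ-fromℕ< n<k))) Sᵤ)))

  misses⇒¬dominating : ∀ {k p} → p < k → Misses p → ¬ Dominating (P k) (S ∘ toℕ)
  misses⇒¬dominating p<k (i , ¬near) = ¬Near⇒¬dominating (≤-trans (toℕ<n i) p<k) ¬near

  module _ {p : ℕ} (periodic : ∀ {n} → p ≤ n → S n → S (suc (suc n))) where

    tail-meets : S p ⊎ S (suc p) → ∀ {n} → p ≤′ n → S n ⊎ S (suc n)
    tail-meets meets ≤′-refl = meets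
    tail-meets meets (≤′-step p≤n) =
      [ inj₂ ∘ periodic (≤′⇒≤ p≤n) , inj₁ ]′ (tail-meets meets p≤n)

    left-or-in : S (pred p) ⊎ S p → S p ⊎ S (suc p) → ∀ {n} → p ≤′ n → S (pred n) ⊎ S n
    left-or-in edge _     ≤′-refl = edge
    left-or-in _    meets (≤′-step p≤n) = tail-meets meets p≤n

    covers⇒dominating : ∀ {k} → p < k → Covers p → Dominating (P k) (S ∘ toℕ)
    covers⇒dominating p<k (prefix , edge , meets) v v∉S with toℕ v <? p
    ... | yes v<p = near-neighbour v v∉S (≤-<-trans v<p p<k)
                      (subst Near (toℕ-fromℕ< v<p) (prefix (fromℕ< v<p)))
    ... | no  v≮p = [ left-neighbour v v∉S , ⊥-elim ∘ v∉S ]′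
                      (left-or-in edge meets (≤⇒≤′ (≮⇒≥ v≮p)))

  module _ (S? : Decidable S) where

    near? : Decidable Near
    near? n = S? (pred n) ⊎-dec S? n ⊎-dec S? (suc n)

    covers? : ∀ p → Dec (Covers p)
    covers? p = all? (near? ∘ toℕ) ×-dec (S? (pred p) ⊎-dec S? p) ×-dec (S? p ⊎-dec S? (suc p))

    misses? : ∀ p → Dec (Misses p)
    misses? p = any? (¬? ∘ near? ∘ toℕ)

open PathDomination using (Covers; Misses; covers⇒dominating; misses⇒¬dominating; covers?; misses?)

module _ {m : ℕ} (f : ℕ → Fin m) where

  Colour : Fin m → ℕ → Set
  Colour a n = f n ≡ a

  Colours : Fin m → Fin m → ℕ → Set
  Colours a b n = Colour a n ⊎ Colour b n

  -- checkable on f 0, …, f (suc p); once f is 2-periodic from p on, it makes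
  -- the coalitions among the classes of f on every P_k with p < k exactly the
  -- edges of H
  record Realises (p : ℕ) (H : Graph m) : Set where
    field
      occurs             : ∀ a → ∃ λ (i : Fin (suc p)) → f (toℕ i) ≡ a
      class-misses       : ∀ a → Misses (Colour a) p
      adjacent-covers    : ∀ a b → Adj H a b → Covers (Colours a b) p
      nonadjacent-misses : ∀ a b → a ≢ b → ¬ Adj H a b → Misses (Colours a b) p

  realises? : ∀ p (H : Graph m) → (∀ a b → Dec (Adj H a b)) → Dec (Realises p H)
  realises? p H adj? = map′
    (λ (o , c , a , n) → record
      { occurs = o ; class-misses = c ; adjacent-covers = a ; nonadjacent-misses = n })
    (λ r → let open Realises r in occurs , class-misses , adjacent-covers , nonadjacent-misses)
    (     all? (λ a → any? (λ i → f (toℕ i) ≟ᶠ a))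
    ×-dec all? (λ a → misses? (Colour a) (colour? a) p)
    ×-dec all? (λ a → all? λ b → adj? a b →-dec covers? (Colours a b) (colours? a b) p)
    ×-dec all? (λ a → all? λ b →
            ¬? (a ≟ᶠ b) →-dec ¬? (adj? a b) →-dec misses? (Colours a b) (colours? a b) p))
    where
    colour? : ∀ a → Decidable (Colour a)
    colour? a n = f n ≟ᶠ a
    colours? : ∀ a b → Decidable (Colours a b)
    colours? a b n = colour? a n ⊎-dec colour? b n

dominating-∪-self : ∀ {n} {G : Graph n} {S : VSet n} → Dominating G (S ∪ S) → Dominating G S
dominating-∪-self dom v v∉S with dom v [ v∉S , v∉S ]′
... | u , Sᵤ , adj = u , Sum.reduce Sᵤ , adj

module Realisation {m p : ℕ} {H : Graph m} (adj? : ∀ a b → Dec (Adj H a b))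
                   (f : ℕ → Fin m) (periodic : ∀ {n} → p ≤ n → f (suc (suc n)) ≡ f n)
                   (realises : Realises f p H) {k : ℕ} (p<k : p < k) where

  open Realises realises

  Ψ : Partition k m
  Ψ = record { cls = f ∘ toℕ ; onto = occurs-below-k }
    where
    occurs-below-k : ∀ a → ∃ λ v → f (toℕ v) ≡ a
    occurs-below-k a with occurs a
    ... | i , fi≡a = inject≤ i p<k , trans (cong f (toℕ-inject≤ i p<k)) fi≡a

  class-not-dominating : ∀ a → ¬ Dominating (P k) (Class Ψ a)
  class-not-dominating a = misses⇒¬dominating (Colour f a) p<k (class-misses a)

  pair-dominating : ∀ {a b} → Adj H a b → Dominating (P k) (Class Ψ a ∪ Class Ψ b)
  pair-dominating {a} {b} adj =
    covers⇒dominating (Colours f a b)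
      (λ p≤n → Sum.map (trans (periodic p≤n)) (trans (periodic p≤n))) p<k (adjacent-covers a b adj)

  adjacent⇒distinct : ∀ {a b} → Adj H a b → a ≢ b
  adjacent⇒distinct {a} adj refl = class-not-dominating a (dominating-∪-self (pair-dominating adj))

  coalition⇔adjacent : ∀ a b → Coalition (P k) Ψ a b ⇔ Adj H a b
  coalition⇔adjacent a b = mk⇔
    (λ (a≢b , _ , _ , dom) → decidable-stable (adj? a b) λ ¬adj →
       misses⇒¬dominating (Colours f a b) p<k (nonadjacent-misses a b a≢b ¬adj) dom)
    (λ adj → adjacent⇒distinct adj , class-not-dominating a , class-not-dominating b , pair-dominating adj)

  coalitionGraph≅ : CG (P k) Ψ ≅ H
  coalitionGraph≅ = ↔-id (Fin m) , coalition⇔adjacent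

  isCoalitionPartition : (∀ a → ∃ (Adj H a)) → IsCoalitionPartition (P k) Ψ
  isCoalitionPartition neighbour a with neighbour a
  ... | b , adj = inj₂ (class-not-dominating a , b , Equivalence.from (coalition⇔adjacent a b) adj)

pathAdj? : ∀ m (a b : Fin m) → Dec (PathAdj m a b)
pathAdj? m a b = (suc (toℕ a) ≟ toℕ b) ⊎-dec (suc (toℕ b) ≟ toℕ a)

path-neighbour : ∀ {m} (a : Fin (suc (suc m))) → ∃ (PathAdj _ a)
path-neighbour fzero    = fsuc fzero , inj₁ refl
path-neighbour (fsuc i) = inject₁ i , inj₂ (cong suc (toℕ-inject₁ i))

alternate : {A : Set} → A → A → ℕ → A
alternate a b zero    = a
alternate a b (suc n) = alternate b a n

eventuallyAlternating : {A : Set} → List A → A → A → ℕ → A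
eventuallyAlternating []       a b n       = alternate a b n
eventuallyAlternating (x ∷ xs) a b zero    = x
eventuallyAlternating (x ∷ xs) a b (suc n) = eventuallyAlternating xs a b n

eventuallyAlternating-periodic : {A : Set} (xs : List A) (a b : A) → ∀ {n} → length xs ≤ n →
  eventuallyAlternating xs a b (suc (suc n)) ≡ eventuallyAlternating xs a b n
eventuallyAlternating-periodic []       a b _         = refl
eventuallyAlternating-periodic (x ∷ xs) a b (s≤s p≤n) = eventuallyAlternating-periodic xs a b p≤n

path-defines-path : ∀ {m} (xs : List (Fin (suc (suc m)))) (a b : Fin (suc (suc m))) →
  Realises (eventuallyAlternating xs a b) (length xs) (P (suc (suc m))) →
  ∀ {k} → length xs < k →
  Σ (Partition k (suc (suc m))) λ Ψ → IsCoalitionPartition (P k) Ψ × (CG (P k) Ψ ≅ P (suc (suc m)))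
path-defines-path xs a b realises p<k =
  Ψ , isCoalitionPartition path-neighbour , coalitionGraph≅
  where
  open Realisation (pathAdj? _) (eventuallyAlternating xs a b)
                   (eventuallyAlternating-periodic xs a b) realises p<k

-- followed by 3 1 3 1 …, the classes are {v₀,v₂}, {v₃,v₅,v₇,…}, {v₁,v₄}, {v₆,v₈,…}
P₄-colours : List (Fin 4)
P₄-colours = # 0 ∷ # 2 ∷ # 0 ∷ # 1 ∷ # 2 ∷ # 1 ∷ []

-- followed by 3 1 3 1 …, the classes are {v₂}, {v₀,v₅,v₇,…}, {v₃}, {v₁,v₆,v₈,…}, {v₄}
P₅-colours : List (Fin 5)
P₅-colours = # 1 ∷ # 3 ∷ # 0 ∷ # 2 ∷ # 4 ∷ # 1 ∷ []

P₄-realised : Realises (eventuallyAlternating P₄-colours (# 3) (# 1)) 6 (P 4)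
P₄-realised =
  from-yes (realises? (eventuallyAlternating P₄-colours (# 3) (# 1)) 6 (P 4) (pathAdj? 4))

P₅-realised : Realises (eventuallyAlternating P₅-colours (# 3) (# 1)) 6 (P 5)
P₅-realised =
  from-yes (realises? (eventuallyAlternating P₅-colours (# 3) (# 1)) 6 (P 5) (pathAdj? 5))

proposition8 : (k : ℕ) → k ≥ 7 →
    (Σ (Partition k 4) λ Ψ₁ → IsCoalitionPartition (P k) Ψ₁ × (CG (P k) Ψ₁ ≅ P 4))
    × (Σ (Partition k 5) λ Ψ₂ → IsCoalitionPartition (P k) Ψ₂ × (CG (P k) Ψ₂ ≅ P 5))
proposition8 k k≥7 =
  path-defines-path P₄-colours (# 3) (# 1) P₄-realised k≥7 ,
  path-defines-path P₅-colours (# 3) (# 1) P₅-realised k≥7
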